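{- Let $\mathbb D=\langle D,\leq_{\mathbb D}\rangle$ be a directed set, $\mathbb I=\langle\langle G_q: q\in D\rangle,\langle h_{q,r}: q\leq_{\mathbb D} r\rangle\rangle$ an inverse system of groups over $\mathbb D$, and $\mathcal M_{\mathbb I}$ the structure described below. For an automorphism $\sigma$ of $\mathcal M_{\mathbb I}$ and $q\in D$, let $c_{\sigma,q}$ be the unique element of $G_q$ with $\sigma(\langle g,q,0\rangle)=\langle c_{\sigma,q}\cdot g,q,0\rangle$ for all $g\in G_q$. Then the map $\Phi:\mathrm{Aut}(\mathcal M_{\mathbb I})\to G_{\mathbb I}$, $\sigma\mapsto(c_{\sigma,q})_{q\in D}$, is a well-defined isomorphism of groups.
   Context: A directed set is a set with a reflexive transitive relation in which any two elements have a common upper bound. An inverse system of groups over it consists of groups $G_q$ and homomorphisms $h_{q,r}:G_r\to G_q$ ($q\leq_{\mathbb D} r$) with $h_{q,q}=\mathrm{id}$ and $h_{q,r}\circ h_{r,s}=h_{q,s}$; its inverse limit is $G_{\mathbb I}=\{(g_q)_{q\in D}\in\prod_q G_q: h_{q,r}(g_r)=g_q\text{ for all }q\leq_{\mathbb D} r\}$. The first-order language $\mathcal L_{\mathbb I}$ has constant symbols $\dot c_{g,q}$ ($q\in D$, $g\in G_q$), unary relation symbols $\dot P_q$, binary relation symbols $\dot H_{q,r}$ ($q\leq_{\mathbb D} r$) and ternary relation symbols $\dot F_q$. The $\mathcal L_{\mathbb I}$-structure $\mathcal M_{\mathbb I}$ has domain $\{\langle g,q,i\rangle: q\in D, g\in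 G_q, i<2\}$, interprets $\dot c_{g,q}$ as $\langle g,q,1\rangle$, $\dot P_q$ as $\{\langle g,q,0\rangle: g\in G_q\}$, $\dot H_{q,r}$ as $\{(\langle g,r,0\rangle,\langle h_{q,r}(g),q,0\rangle): g\in G_r\}$, and $\dot F_q$ as $\{(\langle g,q,0\rangle,\langle h,q,1\rangle,\langle g\cdot h,q,0\rangle): g,h\in G_q\}$. $\mathrm{Aut}(\mathcal M_{\mathbb I})$ is the group of automorphisms of this structure under composition. -}

module Defs where

open import Level using (0ℓ)
open import Data.Bool using (Bool; true; false)
open import Data.Product using (Σ; ∃; _×_; _,_; proj₁; proj₂)
open import Relation.Binary.PropositionalEquality using (_≡_; refl; cong; sym; trans)
open import Relation.Binary.Structures using (IsPreorder)
open import Algebra.Bundles.Raw using (RawGroup)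
open import Algebra.Structures using (IsGroup)
open import Algebra.Morphism.Structures using (IsGroupHomomorphism)
open import Function using (_⇔_; mk⇔; Equivalence)

record DirectedSet : Set₁ where
  field
    D          : Set
    _≤_        : D → D → Set
    isPreorder : IsPreorder _≡_ _≤_
    directed   : ∀ a b → ∃ λ c → (a ≤ c) × (b ≤ c)

rawGrp : (A : Set) → (A → A → A) → A → (A → A) → RawGroup 0ℓ 0ℓ
rawGrp A op e inv = record { Carrier = A ; _≈_ = _≡_ ; _∙_ = op ; ε = e ; _⁻¹ = inv }

-- The bonding maps are
-- indexed by proofs of q ≤ r; functoriality is required for all proofs,
-- which forces h to be independent of the chosen proof.
record InverseSystem (𝔻 : DirectedSet) : Set₁ where
  open DirectedSet 𝔻
  field
    G       : D → Set
    _∙_     : ∀ {q} → G q → G q → G q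
    ε       : ∀ q → G q
    _⁻¹     : ∀ {q} → G q → G q
    isGroup : ∀ q → IsGroup (_≡_ {A = G q}) (_∙_ {q}) (ε q) (_⁻¹ {q})
    h       : ∀ {q r} → q ≤ r → G r → G q
    h-hom   : ∀ {q r} (p : q ≤ r) →
              IsGroupHomomorphism (rawGrp (G r) _∙_ (ε r) _⁻¹)
                                  (rawGrp (G q) _∙_ (ε q) _⁻¹) (h p)
    h-id    : ∀ {q} (p : q ≤ q) (g : G q) → h p g ≡ g
    h-comp  : ∀ {q r s} (p : q ≤ r) (p′ : r ≤ s) (p″ : q ≤ s) (g : G s) →
              h p (h p′ g) ≡ h p″ g

module Structure {𝔻 : DirectedSet} (𝕀 : InverseSystem 𝔻) where
  open DirectedSet 𝔻
  open InverseSystem 𝕀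

  record InvLim : Set where
    field
      val    : (q : D) → G q
      compat : ∀ {q r} (p : q ≤ r) → h p (val r) ≡ val q
  open InvLim public

  -- Domain of M_𝕀: triples ⟨g,q,i⟩ written (q , g , i); i < 2 is a Bool,
  -- false = 0, true = 1.
  M : Set
  M = Σ D λ q → G q × Bool

  cst : (q : D) → G q → M
  cst q g = (q , g , true)

  Pᴹ : D → M → Set
  Pᴹ q x = Σ (G q) λ g → x ≡ (q , g , false)

  Hᴹ : ∀ {q r} → q ≤ r → M → M → Set
  Hᴹ {q} {r} p x y = Σ (G r) λ g → (x ≡ (r , g , false)) × (y ≡ (q , h p g , false))

  Fᴹ : D → M → M → M → Set
  Fᴹ q x y z = Σ (G q) λ g → Σ (G q) λ k →
    (x ≡ (q , g , false)) × (y ≡ (q , k , true)) × (z ≡ (q , g ∙ k , false))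

  record Aut : Set where
    field
      fun    : M → M
      inv    : M → M
      inv-l  : ∀ x → inv (fun x) ≡ x
      inv-r  : ∀ x → fun (inv x) ≡ x
      pres-c : ∀ q (g : G q) → fun (cst q g) ≡ cst q g
      pres-P : ∀ q x → Pᴹ q x ⇔ Pᴹ q (fun x)
      pres-H : ∀ {q r} (p : q ≤ r) x y → Hᴹ p x y ⇔ Hᴹ p (fun x) (fun y)
      pres-F : ∀ q x y z → Fᴹ q x y z ⇔ Fᴹ q (fun x) (fun y) (fun z)
  open Aut public

  private
    ⇔-trans : ∀ {A B C : Set} → A ⇔ B → B ⇔ C → A ⇔ C
    ⇔-trans f g = mk⇔ (λ a → Equivalence.to g (Equivalence.to f a))
                      (λ c → Equivalence.from f (Equivalence.from g c))

  _∘ᴬ_ : Aut → Aut → Aut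
  σ ∘ᴬ τ = record
    { fun    = λ x → fun σ (fun τ x)
    ; inv    = λ x → inv τ (inv σ x)
    ; inv-l  = λ x → trans (cong (inv τ) (inv-l σ (fun τ x))) (inv-l τ x)
    ; inv-r  = λ x → trans (cong (fun σ) (inv-r τ (inv σ x))) (inv-r σ x)
    ; pres-c = λ q g → trans (cong (fun σ) (pres-c τ q g)) (pres-c σ q g)
    ; pres-P = λ q x → ⇔-trans (pres-P τ q x) (pres-P σ q (fun τ x))
    ; pres-H = λ p x y → ⇔-trans (pres-H τ p x y) (pres-H σ p (fun τ x) (fun τ y))
    ; pres-F = λ q x y z → ⇔-trans (pres-F τ q x y z)
                                   (pres-F σ q (fun τ x) (fun τ y) (fun τ z))
    }

module Submission where

-- Automorphisms of M_𝕀 are exactly the translations by elements of the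
-- inverse limit G_𝕀.
--
-- For an automorphism σ and q ∈ D, preservation of P_q sends the point
-- ⟨ε,q,0⟩ to some ⟨c,q,0⟩; this c is the coefficient c_{σ,q}.  Since σ fixes
-- the constants and preserves F_q, the triple (⟨ε,q,0⟩, c_{g,q}, ⟨g,q,0⟩) is
-- sent to (⟨c,q,0⟩, c_{g,q}, σ⟨g,q,0⟩), so σ⟨g,q,0⟩ = ⟨c·g,q,0⟩: σ acts on the
-- q-th sort as left translation by c_{σ,q}.  Preservation of H_{q,r} makes
-- the coefficients compatible, so Φ(σ) lies in G_𝕀; composition of
-- translations multiplies coefficients; and σ is determined by Φ(σ) because
-- it fixes all constants.  Conversely, translation by c ∈ G_𝕀 preserves every
-- relation (H because the bonding maps are homomorphisms and c is
-- compatible), and so does translation by c⁻¹, its inverse; a bijection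
-- whose inverse also preserves the relations is an automorphism.

open import Defs
open import Level using (0ℓ)
open import Data.Bool using (Bool; true; false)
open import Data.Product using (Σ; _×_; _,_; proj₁; proj₂)
open import Relation.Binary.PropositionalEquality
  using (_≡_; refl; sym; trans; cong; cong₂; subst; subst₂; module ≡-Reasoning)
open import Function using (_∘_; _⇔_; mk⇔; Equivalence)
open import Algebra.Bundles using (Group)
open import Algebra.Structures using (IsGroup)
open import Algebra.Morphism.Structures using (IsGroupHomomorphism)
import Algebra.Properties.Group as GroupProperties

module AutomorphismsOfM (𝔻 : DirectedSet) (𝕀 : InverseSystem 𝔻) where
  open DirectedSet 𝔻
  open InverseSystem 𝕀
  open Structure 𝕀
  open ≡-Reasoning

  group : D → Group 0ℓ 0ℓ
  group q = record { Carrier = G q ; _≈_ = _≡_ ; _∙_ = _∙_ ; ε = ε q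
                   ; _⁻¹ = _⁻¹ ; isGroup = isGroup q }

  module Law {q : D} = IsGroup (isGroup q)
  module DerivedLaw {q : D} = GroupProperties (group q)
  module Bonding {q r : D} (p : q ≤ r) = IsGroupHomomorphism (h-hom p)

  pt : (q : D) → G q → M
  pt q g = (q , g , false)

  point-injective : ∀ {q} {a b : G q} {i : Bool} →
                    _≡_ {A = M} (q , a , i) (q , b , i) → a ≡ b
  point-injective refl = refl

  record PreservesRelations (f : M → M) : Set where
    field
      map-P : ∀ q x → Pᴹ q x → Pᴹ q (f x)
      map-H : ∀ {q r} (p : q ≤ r) x y → Hᴹ p x y → Hᴹ p (f x) (f y)
      map-F : ∀ q x y z → Fᴹ q x y z → Fᴹ q (f x) (f y) (f z)
  open PreservesRelations

  -- A bijection fixing the constants, such that it and its inverse both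
  -- preserve the relations, is an automorphism: the reverse implications
  -- come from applying the inverse and cancelling.
  mkAut : (f g : M → M) → (∀ x → g (f x) ≡ x) → (∀ x → f (g x) ≡ x) →
          (∀ q a → f (cst q a) ≡ cst q a) →
          PreservesRelations f → PreservesRelations g → Aut
  mkAut f g gf fg fixes-c pf pg = record
    { fun    = f
    ; inv    = g
    ; inv-l  = gf
    ; inv-r  = fg
    ; pres-c = fixes-c
    ; pres-P = λ q x → mk⇔ (map-P pf q x)
                           (subst (Pᴹ q) (gf x) ∘ map-P pg q (f x))
    ; pres-H = λ p x y → mk⇔ (map-H pf p x y)
                             (subst₂ (Hᴹ p) (gf x) (gf y) ∘ map-H pg p (f x) (f y))
    ; pres-F = λ q x y z → mk⇔ (map-F pf q x y z)
        (λ r → subst (λ w → Fᴹ q w y z) (gf x)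
                 (subst₂ (Fᴹ q (g (f x))) (gf y) (gf z)
                   (map-F pg q (f x) (f y) (f z) r)))
    }

  translate : ((q : D) → G q) → M → M
  translate c (q , g , false) = pt q (c q ∙ g)
  translate c (q , g , true)  = (q , g , true)

  translate-inverseˡ : ∀ c x → translate (λ q → c q ⁻¹) (translate c x) ≡ x
  translate-inverseˡ c (q , g , false) = cong (pt q) (DerivedLaw.\\-leftDividesʳ (c q) g)
  translate-inverseˡ c (q , g , true)  = refl

  translate-inverseʳ : ∀ c x → translate c (translate (λ q → c q ⁻¹) x) ≡ x
  translate-inverseʳ c (q , g , false) = cong (pt q) (DerivedLaw.\\-leftDividesˡ (c q) g)
  translate-inverseʳ c (q , g , true)  = refl

  bonding-translate : (c : InvLim) → ∀ {q r} (p : q ≤ r) (g : G r) →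
                      h p (val c r ∙ g) ≡ val c q ∙ h p g
  bonding-translate c {q} {r} p g = begin
    h p (val c r ∙ g)        ≡⟨ Bonding.homo p (val c r) g ⟩
    h p (val c r) ∙ h p g    ≡⟨ cong (_∙ h p g) (compat c p) ⟩
    val c q ∙ h p g          ∎

  translate-preserves : (c : InvLim) → PreservesRelations (translate (val c))
  translate-preserves c = record { map-P = P ; map-H = H ; map-F = F }
    where
    P : ∀ q x → Pᴹ q x → Pᴹ q (translate (val c) x)
    P q _ (g , refl) = (val c q ∙ g , refl)

    H : ∀ {q r} (p : q ≤ r) x y → Hᴹ p x y →
        Hᴹ p (translate (val c) x) (translate (val c) y)
    H {q} {r} p _ _ (g , refl , refl) =
      (val c r ∙ g , refl , cong (pt q) (sym (bonding-translate c p g)))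

    F : ∀ q x y z → Fᴹ q x y z →
        Fᴹ q (translate (val c) x) (translate (val c) y) (translate (val c) z)
    F q _ _ _ (g , k , refl , refl , refl) =
      (val c q ∙ g , k , refl , refl , cong (pt q) (sym (Law.assoc (val c q) g k)))

  _⁻¹ᴵ : InvLim → InvLim
  c ⁻¹ᴵ = record
    { val    = λ q → val c q ⁻¹
    ; compat = λ p → trans (Bonding.⁻¹-homo p (val c _)) (cong _⁻¹ (compat c p))
    }

  translationAut : InvLim → Aut
  translationAut c =
    mkAut (translate (val c)) (translate (val (c ⁻¹ᴵ)))
          (translate-inverseˡ (val c)) (translate-inverseʳ (val c))
          (λ q a → refl) (translate-preserves c) (translate-preserves (c ⁻¹ᴵ))

  coeff : Aut → (q : D) → G q
  coeff σ q = proj₁ (Equivalence.to (pres-P σ q (pt q (ε q))) (ε q , refl))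

  coeff-spec : ∀ σ q → fun σ (pt q (ε q)) ≡ pt q (coeff σ q)
  coeff-spec σ q = proj₂ (Equivalence.to (pres-P σ q (pt q (ε q))) (ε q , refl))

  -- σ acts on P_q as left translation by c_{σ,q}, via F_q applied to
  -- the triple (⟨ε,q,0⟩, c_{g,q}, ⟨ε·g,q,0⟩) whose middle entry σ fixes.
  translation-law : ∀ σ q g → fun σ (pt q g) ≡ pt q (coeff σ q ∙ g)
  translation-law σ q g
    with Equivalence.to (pres-F σ q (pt q (ε q)) (cst q g) (pt q (ε q ∙ g)))
                        (ε q , g , refl , refl , refl)
  ... | (a , k , σε≡a , σg≡k , σεg≡ak) = begin
    fun σ (pt q g)           ≡⟨ cong (fun σ ∘ pt q) (sym (Law.identityˡ g)) ⟩
    fun σ (pt q (ε q ∙ g))   ≡⟨ σεg≡ak ⟩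
    pt q (a ∙ k)             ≡⟨ cong₂ (λ a′ k′ → pt q (a′ ∙ k′)) a≡coeff k≡g ⟩
    pt q (coeff σ q ∙ g)     ∎
    where
    a≡coeff = point-injective (trans (sym σε≡a) (coeff-spec σ q))
    k≡g     = point-injective (trans (sym σg≡k) (pres-c σ q g))

  -- A translation coefficient is unique: evaluate both laws at ε.
  coeff-unique : ∀ (σ : Aut) (q : D) (c c′ : G q) →
    (∀ g → fun σ (pt q g) ≡ pt q (c ∙ g)) →
    (∀ g → fun σ (pt q g) ≡ pt q (c′ ∙ g)) → c ≡ c′
  coeff-unique σ q c c′ law law′ = begin
    c          ≡⟨ sym (Law.identityʳ c) ⟩
    c ∙ ε q    ≡⟨ point-injective (trans (sym (law (ε q))) (law′ (ε q))) ⟩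
    c′ ∙ ε q   ≡⟨ Law.identityʳ c′ ⟩
    c′         ∎

  -- The coefficients form an element of G_𝕀, by H_{q,r} applied to the
  -- pair (⟨ε,r,0⟩, ⟨ε,q,0⟩).
  coeff-compatible : ∀ σ {q r} (p : q ≤ r) → h p (coeff σ r) ≡ coeff σ q
  coeff-compatible σ {q} {r} p
    with Equivalence.to (pres-H σ p (pt r (ε r)) (pt q (ε q)))
                        (ε r , refl , cong (pt q) (sym (Bonding.ε-homo p)))
  ... | (g , σεr≡g , σεq≡hg) = begin
    h p (coeff σ r)  ≡⟨ cong (h p) (point-injective (trans (sym (coeff-spec σ r)) σεr≡g)) ⟩
    h p g            ≡⟨ point-injective (trans (sym σεq≡hg) (coeff-spec σ q)) ⟩
    coeff σ q        ∎

  Φ : Aut → InvLim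
  Φ σ = record { val = coeff σ ; compat = coeff-compatible σ }

  -- Φ is a homomorphism: composing translations multiplies coefficients.
  coeff-∘ : ∀ (σ τ : Aut) (q : D) → coeff (σ ∘ᴬ τ) q ≡ coeff σ q ∙ coeff τ q
  coeff-∘ σ τ q = coeff-unique (σ ∘ᴬ τ) q _ _ (translation-law (σ ∘ᴬ τ) q) composite
    where
    composite : ∀ g → fun σ (fun τ (pt q g)) ≡ pt q ((coeff σ q ∙ coeff τ q) ∙ g)
    composite g = begin
      fun σ (fun τ (pt q g))              ≡⟨ cong (fun σ) (translation-law τ q g) ⟩
      fun σ (pt q (coeff τ q ∙ g))        ≡⟨ translation-law σ q (coeff τ q ∙ g) ⟩
      pt q (coeff σ q ∙ (coeff τ q ∙ g))  ≡⟨ cong (pt q) (sym (Law.assoc _ _ _)) ⟩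
      pt q ((coeff σ q ∙ coeff τ q) ∙ g)  ∎

  -- Φ is injective: an automorphism is determined by its coefficients,
  -- as it fixes all constants.
  coeff-determines : ∀ (σ τ : Aut) → (∀ q → coeff σ q ≡ coeff τ q) →
                     ∀ x → fun σ x ≡ fun τ x
  coeff-determines σ τ same (q , g , false) = begin
    fun σ (pt q g)          ≡⟨ translation-law σ q g ⟩
    pt q (coeff σ q ∙ g)    ≡⟨ cong (λ c → pt q (c ∙ g)) (same q) ⟩
    pt q (coeff τ q ∙ g)    ≡⟨ sym (translation-law τ q g) ⟩
    fun τ (pt q g)          ∎
  coeff-determines σ τ same (q , g , true) = trans (pres-c σ q g) (sym (pres-c τ q g))

  coeff-translationAut : ∀ (c : InvLim) q → coeff (translationAut c) q ≡ val c q
  coeff-translationAut c q =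
    coeff-unique (translationAut c) q _ _ (translation-law (translationAut c) q) (λ g → refl)

lemma2p11 : (𝔻 : DirectedSet) (𝕀 : InverseSystem 𝔻) →
  let open DirectedSet 𝔻
      open InverseSystem 𝕀
      open Structure 𝕀
  in
  -- uniqueness of c_{σ,q}
  (∀ (σ : Aut) (q : D) (c c′ : G q) →
     (∀ g → fun σ (q , g , false) ≡ (q , c ∙ g , false)) →
     (∀ g → fun σ (q , g , false) ≡ (q , c′ ∙ g , false)) → c ≡ c′)
  ×
  -- Φ : Aut(M_𝕀) → G_𝕀, σ ↦ (c_{σ,q})_q, is well defined and a group isomorphism
  Σ (Aut → InvLim) λ Φ →
    (∀ (σ : Aut) (q : D) (g : G q) →
       fun σ (q , g , false) ≡ (q , val (Φ σ) q ∙ g , false))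
    × (∀ (σ τ : Aut) (q : D) → val (Φ (σ ∘ᴬ τ)) q ≡ val (Φ σ) q ∙ val (Φ τ) q)
    × (∀ (σ τ : Aut) → (∀ q → val (Φ σ) q ≡ val (Φ τ) q) → ∀ x → fun σ x ≡ fun τ x)
    × (∀ (c : InvLim) → Σ Aut λ σ → ∀ q → val (Φ σ) q ≡ val c q)
lemma2p11 𝔻 𝕀 =
    coeff-unique
  , Φ
  , translation-law
  , coeff-∘
  , coeff-determines
  , (λ c → translationAut c , coeff-translationAut c)
  where open AutomorphismsOfM 𝔻 𝕀
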